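{- (Substitution in terms preserves the type.) Let $g:\mathbb N\to\mathbb N$ satisfy $h<g(h)$ for all $h$. For every environment $C$, variable $x$ and terms $T_1,T_2,T,V$: if $C\vdash_g T_1:T$, $T_1[x:=^+V]\,T_2$, and $C=E\cdot\delta x{=}V\cdot E'$ for some environments $E,E'$, then $C\vdash_g T_2:T$.
   Context: Terms of $\lambda\delta$: $T ::= \ast h \mid x \mid \lambda x{:}W.\,T \mid \delta x{=}V.\,T \mid \mathrm{appl}(V,T) \mid \mathrm{cast}(W,T)$ ($h\in\mathbb N$, $x$ a variable); $\ast h$ is a sort, $\lambda x{:}W.T$ abstraction over type $W$, $\delta x{=}V.T$ the abbreviation "let $x=V$ in $T$", $\mathrm{appl}(V,T)$ application of $T$ to argument $V$, $\mathrm{cast}(W,T)$ $T$ annotated with type $W$. In $\lambda x{:}W.T$, $\delta x{=}V.T$, $x$ is bound in $T$ only; $\mathrm{FV}(T)$ free variables; terms up to renaming of bound variables with bound and free names disjoint. Environments: $E ::= \ast h \mid \lambda x{:}W.E \mid \delta x{=}V.E \mid \mathrm{appl}(V,E)\mid\mathrm{cast}(W,E)$. $E.\lambda x{:}W$ (resp. $E.\delta x{=}V$) is $E$ with its terminal sort $\ast h$ replaced by $\lambda x{:}W.\ast h$ (resp. $\delta x{=}V.\ast h$). $E=C_1\cdot\beta\cdot C_2$, for an item $\beta$ of the form $\lambda x{:}W$ or $\delta x{=}V$, means $E$ is obtained from the environment $C_1$ by replacing its terminal sort with $\beta.C_2$ for the environment $C_2$. Strict substitution: $T[x:=^+W]\,T'$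 iff $x\notin\mathrm{FV}(W)$, $x\in\mathrm{FV}(T)$ and $T'$ arises from $T$ by replacing a nonempty set of free occurrences of $x$ by $W$. Environment-free parallel reduction $\to_0$: least relation closed under (refl) $T\to_0T$; (compatibility) if $A_1\to_0A_2$, $T_1\to_0T_2$ then $\lambda x{:}A_1.T_1\to_0\lambda x{:}A_2.T_2$, $\delta x{=}A_1.T_1\to_0\delta x{=}A_2.T_2$, $\mathrm{appl}(A_1,T_1)\to_0\mathrm{appl}(A_2,T_2)$, $\mathrm{cast}(A_1,T_1)\to_0\mathrm{cast}(A_2,T_2)$; ($\beta$) if $V_1\to_0V_2$, $T_1\to_0T_2$ then $\mathrm{appl}(V_1,\lambda x{:}W.T_1)\to_0\delta x{=}V_2.T_2$; ($\delta$) if $V_1\to_0V_2$, $T_1\to_0T_2$, $T_2[x:=^+V_2]T$ then $\delta x{=}V_1.T_1\to_0\delta x{=}V_2.T$; ($\zeta$) if $T_1\to_0T_2$, $x\notin\mathrm{FV}(T_1)$ then $\delta x{=}V.T_1\to_0T_2$; ($\tau$) if $T_1\to_0T_2$ then $\mathrm{cast}(W,T_1)\to_0T_2$; ($\upsilon$) if $V_1\to_0V_3$, $V_2\to_0V_4$, $T_1\to_0T_2$ then $\mathrm{appl}(V_1,\delta x{=}V_2.T_1)\to_0\delta x{=}V_4.\mathrm{appl}(V_3,T_2)$. $E\vdash T_1\to T_2$ iff $T_1\to_0T_2$, or $E=C_1\cdot\delta x{=}V\cdot C_2$, $T_1\to_0T'$, $T'[x:=^+V]T_2$. Conversion $E\vdash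 T_1\Leftrightarrow T_2$ is its symmetric and transitive closure. Native type assignment $E\vdash_g T:U$ is the least relation closed under: (sort) $E\vdash_g\ast h:\ast g(h)$; (def) if $E=C_1\cdot\delta x{=}V\cdot C_2$ and $C_1\vdash_g V:W$ then $E\vdash_g x:W$; (decl) if $E=C_1\cdot\lambda x{:}W\cdot C_2$ and $C_1\vdash_g W:V$ then $E\vdash_g x:W$; (abbr) if $E\vdash_g V:W$ and $E.\delta x{=}V\vdash_g T:U$ then $E\vdash_g\delta x{=}V.T:\delta x{=}V.U$; (abst) if $E\vdash_g W:V$ and $E.\lambda x{:}W\vdash_g T:U$ then $E\vdash_g\lambda x{:}W.T:\lambda x{:}W.U$; (appl) if $E\vdash_g V:W$ and $E\vdash_g T:\lambda x{:}W.U$ then $E\vdash_g\mathrm{appl}(V,T):\mathrm{appl}(V,\lambda x{:}W.U)$; (cast) if $E\vdash_g T:W$ and $E\vdash_g W:V$ then $E\vdash_g\mathrm{cast}(W,T):\mathrm{cast}(V,W)$; (conv) if $E\vdash_g U_2:W$, $E\vdash_g T:U_1$ and $E\vdash U_1\Leftrightarrow U_2$ then $E\vdash_g T:U_2$. -}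

module Defs where

open import Data.Nat using (ℕ; zero; suc; _+_; _<ᵇ_)
open import Data.Bool using (Bool; true; false; if_then_else_; _∨_)
open import Data.Product using (_×_)
open import Relation.Nullary using (¬_)
open import Relation.Binary.PropositionalEquality using (_≡_)

-- Terms of λδ, with variables as de Bruijn indices
-- (this represents terms up to renaming of bound variables).
-- Only λ and δ bind (one variable each, bound in the body T only).

data Term : Set where
  sort : ℕ → Term
  var  : ℕ → Term
  lam  : Term → Term → Term       -- lam W T  = λx:W. T
  abbr : Term → Term → Term       -- abbr V T = δx=V. T
  appl : Term → Term → Term
  cast : Term → Term → Term

lift : ℕ → ℕ → Term → Term
lift d k (sort h)   = sort h
lift d k (var j)    = if j <ᵇ k then var j else var (j + d)
lift d k (lam W T)  = lam (lift d k W) (lift d (suc k) T)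
lift d k (abbr V T) = abbr (lift d k V) (lift d (suc k) T)
lift d k (appl V T) = appl (lift d k V) (lift d k T)
lift d k (cast W T) = cast (lift d k W) (lift d k T)

data Occurs : ℕ → Term → Set where
  var   : ∀ {i} → Occurs i (var i)
  lam₁  : ∀ {i W T} → Occurs i W → Occurs i (lam W T)
  lam₂  : ∀ {i W T} → Occurs (suc i) T → Occurs i (lam W T)
  abbr₁ : ∀ {i V T} → Occurs i V → Occurs i (abbr V T)
  abbr₂ : ∀ {i V T} → Occurs (suc i) T → Occurs i (abbr V T)
  appl₁ : ∀ {i V T} → Occurs i V → Occurs i (appl V T)
  appl₂ : ∀ {i V T} → Occurs i T → Occurs i (appl V T)
  cast₁ : ∀ {i W T} → Occurs i W → Occurs i (cast W T)
  cast₂ : ∀ {i W T} → Occurs i T → Occurs i (cast W T)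

-- Replace : i V T T' b  :  T' arises from T by replacing some set of free
-- occurrences of variable i by V; b = true iff that set is nonempty.
-- (Under a binder, i becomes suc i and V is lifted by one.)
data Replace : ℕ → Term → Term → Term → Bool → Set where
  sort : ∀ {i V h} → Replace i V (sort h) (sort h) false
  keep : ∀ {i V j} → Replace i V (var j) (var j) false
  here : ∀ {i V} → Replace i V (var i) V true
  lam  : ∀ {i V W W' T T' b₁ b₂} → Replace i V W W' b₁ →
         Replace (suc i) (lift 1 0 V) T T' b₂ →
         Replace i V (lam W T) (lam W' T') (b₁ ∨ b₂)
  abbr : ∀ {i V A A' T T' b₁ b₂} → Replace i V A A' b₁ →
         Replace (suc i) (lift 1 0 V) T T' b₂ →
         Replace i V (abbr A T) (abbr A' T') (b₁ ∨ b₂)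
  appl : ∀ {i V A A' T T' b₁ b₂} → Replace i V A A' b₁ →
         Replace i V T T' b₂ →
         Replace i V (appl A T) (appl A' T') (b₁ ∨ b₂)
  cast : ∀ {i V A A' T T' b₁ b₂} → Replace i V A A' b₁ →
         Replace i V T T' b₂ →
         Replace i V (cast A T) (cast A' T') (b₁ ∨ b₂)

_[_:=⁺_]_ : Term → ℕ → Term → Term → Set
T [ x :=⁺ W ] T' = ¬ Occurs x W × Occurs x T × Replace x W T T' true

infix 4 _→₀_
data _→₀_ : Term → Term → Set where
  refl  : ∀ {T} → T →₀ T
  lam   : ∀ {A₁ A₂ T₁ T₂} → A₁ →₀ A₂ → T₁ →₀ T₂ → lam A₁ T₁ →₀ lam A₂ T₂
  abbr  : ∀ {A₁ A₂ T₁ T₂} → A₁ →₀ A₂ → T₁ →₀ T₂ → abbr A₁ T₁ →₀ abbr A₂ T₂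
  appl  : ∀ {A₁ A₂ T₁ T₂} → A₁ →₀ A₂ → T₁ →₀ T₂ → appl A₁ T₁ →₀ appl A₂ T₂
  cast  : ∀ {A₁ A₂ T₁ T₂} → A₁ →₀ A₂ → T₁ →₀ T₂ → cast A₁ T₁ →₀ cast A₂ T₂
  β     : ∀ {V₁ V₂ W T₁ T₂} → V₁ →₀ V₂ → T₁ →₀ T₂ →
          appl V₁ (lam W T₁) →₀ abbr V₂ T₂
  -- the bound variable x has index 0 in T₂; V₂ seen under the binder is lifted
  δ     : ∀ {V₁ V₂ T₁ T₂ T} → V₁ →₀ V₂ → T₁ →₀ T₂ →
          T₂ [ 0 :=⁺ lift 1 0 V₂ ] T →
          abbr V₁ T₁ →₀ abbr V₂ T
  -- x ∉ FV(T₁): T₁ is (the lift of) a term T₁' not mentioning x;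
  -- the result T₂ is read outside the binder (T₂' = lift of T₂)
  ζ     : ∀ {V T₁ T₁' T₂' T₂} → T₁ ≡ lift 1 0 T₁' → T₁ →₀ T₂' →
          T₂' ≡ lift 1 0 T₂ → abbr V T₁ →₀ T₂
  τ     : ∀ {W T₁ T₂} → T₁ →₀ T₂ → cast W T₁ →₀ T₂
  υ     : ∀ {V₁ V₂ V₃ V₄ T₁ T₂} → V₁ →₀ V₃ → V₂ →₀ V₄ → T₁ →₀ T₂ →
          appl V₁ (abbr V₂ T₁) →₀ abbr V₄ (appl (lift 1 0 V₃) T₂)

-- Environments (the terminal sort is the innermost position)

data Env : Set where
  sort : ℕ → Env
  lam  : Term → Env → Env
  abbr : Term → Env → Env
  appl : Term → Env → Env
  cast : Term → Env → Env

data Item : Set where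
  λ[_] : Term → Item
  δ[_] : Term → Item

plug : Env → Env → Env
plug (sort h)   F = F
plug (lam W E)  F = lam W (plug E F)
plug (abbr V E) F = abbr V (plug E F)
plug (appl V E) F = appl V (plug E F)
plug (cast W E) F = cast W (plug E F)

terminal : Env → ℕ
terminal (sort h)   = h
terminal (lam _ E)  = terminal E
terminal (abbr _ E) = terminal E
terminal (appl _ E) = terminal E
terminal (cast _ E) = terminal E

_,λ_ : Env → Term → Env
E ,λ W = plug E (lam W (sort (terminal E)))

_,δ_ : Env → Term → Env
E ,δ V = plug E (abbr V (sort (terminal E)))

_·_·_ : Env → Item → Env → Env
C₁ · λ[ W ] · C₂ = plug C₁ (lam W C₂)
C₁ · δ[ V ] · C₂ = plug C₁ (abbr V C₂)

-- number of binders (λ/δ items) of an environment;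
-- in E = C₁·β·C₂ the variable bound by β has index  binders C₂
binders : Env → ℕ
binders (sort h)   = 0
binders (lam _ E)  = suc (binders E)
binders (abbr _ E) = suc (binders E)
binders (appl _ E) = binders E
binders (cast _ E) = binders E

infix 4 _⊢_⟶_ _⊢_⇔_
data _⊢_⟶_ (E : Env) : Term → Term → Set where
  free  : ∀ {T₁ T₂} → T₁ →₀ T₂ → E ⊢ T₁ ⟶ T₂
  unfold : ∀ {C₁ V C₂ T₁ T' T₂} → E ≡ C₁ · δ[ V ] · C₂ → T₁ →₀ T' →
           T' [ binders C₂ :=⁺ lift (suc (binders C₂)) 0 V ] T₂ →
           E ⊢ T₁ ⟶ T₂

data _⊢_⇔_ (E : Env) : Term → Term → Set where
  step  : ∀ {T₁ T₂} → E ⊢ T₁ ⟶ T₂ → E ⊢ T₁ ⇔ T₂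
  sym   : ∀ {T₁ T₂} → E ⊢ T₁ ⇔ T₂ → E ⊢ T₂ ⇔ T₁
  trans : ∀ {T₁ T₂ T₃} → E ⊢ T₁ ⇔ T₂ → E ⊢ T₂ ⇔ T₃ → E ⊢ T₁ ⇔ T₃

data _⊢[_]_∶_ : Env → (ℕ → ℕ) → Term → Term → Set where
  sort : ∀ {E g h} → E ⊢[ g ] sort h ∶ sort (g h)
  def  : ∀ {E g C₁ V C₂ W} → E ≡ C₁ · δ[ V ] · C₂ → C₁ ⊢[ g ] V ∶ W →
         E ⊢[ g ] var (binders C₂) ∶ lift (suc (binders C₂)) 0 W
  decl : ∀ {E g C₁ W C₂ V} → E ≡ C₁ · λ[ W ] · C₂ → C₁ ⊢[ g ] W ∶ V →
         E ⊢[ g ] var (binders C₂) ∶ lift (suc (binders C₂)) 0 W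
  abbr : ∀ {E g V W T U} → E ⊢[ g ] V ∶ W → (E ,δ V) ⊢[ g ] T ∶ U →
         E ⊢[ g ] abbr V T ∶ abbr V U
  abst : ∀ {E g W V T U} → E ⊢[ g ] W ∶ V → (E ,λ W) ⊢[ g ] T ∶ U →
         E ⊢[ g ] lam W T ∶ lam W U
  appl : ∀ {E g V W T U} → E ⊢[ g ] V ∶ W → E ⊢[ g ] T ∶ lam W U →
         E ⊢[ g ] appl V T ∶ appl V (lam W U)
  cast : ∀ {E g T W V} → E ⊢[ g ] T ∶ W → E ⊢[ g ] W ∶ V →
         E ⊢[ g ] cast W T ∶ cast V W
  conv : ∀ {E g T U₁ U₂ W} → E ⊢[ g ] U₂ ∶ W → E ⊢[ g ] T ∶ U₁ →
         E ⊢ U₁ ⇔ U₂ → E ⊢[ g ] T ∶ U₂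

{-# OPTIONS --safe #-}
module Submission where

-- Induction on the typing derivation, generalised so that the δ-bound variable may also be
-- replaced inside the items of the environment below its binder: the abbr and abst rules type
-- their bodies in an extended environment whose new item is itself affected by the replacement.
-- Wherever a replacement changes a type, the new type converts back to the original one by
-- unfolding the δ-bound variable, so the conv rule restores the original type; its premise that
-- the original type is typed comes from type validity, which rests on weakening.

open import Defs renaming (sym to ⇔-sym; trans to ⇔-trans)
open import Data.Nat using (ℕ; zero; suc; _+_; _<ᵇ_; _≤_; _<_; z≤n; s≤s; _<?_)
open import Data.Nat.Properties
open import Data.Bool using (Bool; true; false; if_then_else_; _∨_)
open import Data.Bool.Properties using (∨-conicalˡ; ∨-conicalʳ)
open import Data.Product using (_×_; _,_; Σ-syntax; ∃; proj₂)
open import Data.Sum using (_⊎_; inj₁; inj₂)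
open import Data.Empty using (⊥-elim)
open import Relation.Nullary using (¬_; yes; no)
open import Relation.Binary.PropositionalEquality
open import Algebra.Properties.CommutativeSemigroup +-commutativeSemigroup using (xy∙z≈xz∙y)

liftIdx : ℕ → ℕ → ℕ → ℕ
liftIdx d k i = if i <ᵇ k then i else i + d

lift-var : ∀ d k i → lift d k (var i) ≡ var (liftIdx d k i)
lift-var d k i with i <ᵇ k
... | true  = refl
... | false = refl

liftIdx-suc : ∀ d k i → liftIdx d (suc k) (suc i) ≡ suc (liftIdx d k i)
liftIdx-suc d k i with i <ᵇ k
... | true  = refl
... | false = refl

liftIdx-< : ∀ {d k i} → i < k → liftIdx d k i ≡ i
liftIdx-< {d} {suc k} {zero}  _       = refl
liftIdx-< {d} {suc k} {suc i} (s≤s p) = trans (liftIdx-suc d k i) (cong suc (liftIdx-< p))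

liftIdx-≥ : ∀ {d k i} → k ≤ i → liftIdx d k i ≡ i + d
liftIdx-≥ {d} {zero}  {i}     _       = refl
liftIdx-≥ {d} {suc k} {suc i} (s≤s p) = trans (liftIdx-suc d k i) (cong suc (liftIdx-≥ p))

liftIdx-comm : ∀ d m k j v → j ≤ k →
               liftIdx d (k + m) (liftIdx m j v) ≡ liftIdx m j (liftIdx d k v)
liftIdx-comm d m k j v j≤k with v <? j | v <? k
... | yes v<j | _ = begin
  liftIdx d (k + m) (liftIdx m j v)  ≡⟨ cong (liftIdx d (k + m)) (liftIdx-< v<j) ⟩
  liftIdx d (k + m) v                ≡⟨ liftIdx-< (≤-trans (<-≤-trans v<j j≤k) (m≤m+n k m)) ⟩
  v                                  ≡⟨ liftIdx-< v<j ⟨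
  liftIdx m j v                      ≡⟨ cong (liftIdx m j) (liftIdx-< (<-≤-trans v<j j≤k)) ⟨
  liftIdx m j (liftIdx d k v)        ∎
  where open ≡-Reasoning
... | no v≮j | yes v<k = begin
  liftIdx d (k + m) (liftIdx m j v)  ≡⟨ cong (liftIdx d (k + m)) (liftIdx-≥ (≮⇒≥ v≮j)) ⟩
  liftIdx d (k + m) (v + m)          ≡⟨ liftIdx-< (+-monoˡ-< m v<k) ⟩
  v + m                              ≡⟨ liftIdx-≥ (≮⇒≥ v≮j) ⟨
  liftIdx m j v                      ≡⟨ cong (liftIdx m j) (liftIdx-< v<k) ⟨
  liftIdx m j (liftIdx d k v)        ∎
  where open ≡-Reasoning
... | no v≮j | no v≮k = begin
  liftIdx d (k + m) (liftIdx m j v)  ≡⟨ cong (liftIdx d (k + m)) (liftIdx-≥ (≮⇒≥ v≮j)) ⟩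
  liftIdx d (k + m) (v + m)          ≡⟨ liftIdx-≥ (+-monoˡ-≤ m (≮⇒≥ v≮k)) ⟩
  v + m + d                          ≡⟨ xy∙z≈xz∙y v m d ⟩
  v + d + m                          ≡⟨ liftIdx-≥ (≤-trans (≤-trans j≤k (≮⇒≥ v≮k)) (m≤m+n v d)) ⟨
  liftIdx m j (v + d)                ≡⟨ cong (liftIdx m j) (liftIdx-≥ (≮⇒≥ v≮k)) ⟨
  liftIdx m j (liftIdx d k v)        ∎
  where open ≡-Reasoning

liftIdx-merge : ∀ d m k j v → j ≤ k → k ≤ j + m →
                liftIdx d k (liftIdx m j v) ≡ liftIdx (m + d) j v
liftIdx-merge d m k j v j≤k k≤j+m with v <? j
... | yes v<j = begin
  liftIdx d k (liftIdx m j v)  ≡⟨ cong (liftIdx d k) (liftIdx-< v<j) ⟩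
  liftIdx d k v                ≡⟨ liftIdx-< (<-≤-trans v<j j≤k) ⟩
  v                            ≡⟨ liftIdx-< v<j ⟨
  liftIdx (m + d) j v          ∎
  where open ≡-Reasoning
... | no v≮j = begin
  liftIdx d k (liftIdx m j v)  ≡⟨ cong (liftIdx d k) (liftIdx-≥ (≮⇒≥ v≮j)) ⟩
  liftIdx d k (v + m)          ≡⟨ liftIdx-≥ (≤-trans k≤j+m (+-monoˡ-≤ m (≮⇒≥ v≮j))) ⟩
  v + m + d                    ≡⟨ +-assoc v m d ⟩
  v + (m + d)                  ≡⟨ liftIdx-≥ (≮⇒≥ v≮j) ⟨
  liftIdx (m + d) j v          ∎
  where open ≡-Reasoning

lift-comm : ∀ d m k j T → j ≤ k → lift d (k + m) (lift m j T) ≡ lift m j (lift d k T)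
lift-comm d m k j (sort h)   j≤k = refl
lift-comm d m k j (var v)    j≤k = begin
  lift d (k + m) (lift m j (var v))        ≡⟨ cong (lift d (k + m)) (lift-var m j v) ⟩
  lift d (k + m) (var (liftIdx m j v))     ≡⟨ lift-var d (k + m) _ ⟩
  var (liftIdx d (k + m) (liftIdx m j v))  ≡⟨ cong var (liftIdx-comm d m k j v j≤k) ⟩
  var (liftIdx m j (liftIdx d k v))        ≡⟨ lift-var m j _ ⟨
  lift m j (var (liftIdx d k v))           ≡⟨ cong (lift m j) (lift-var d k v) ⟨
  lift m j (lift d k (var v))              ∎
  where open ≡-Reasoning
lift-comm d m k j (lam W T)  j≤k = cong₂ lam (lift-comm d m k j W j≤k) (lift-comm d m (suc k) (suc j) T (s≤s j≤k))
lift-comm d m k j (abbr V T) j≤k = cong₂ abbr (lift-comm d m k j V j≤k) (lift-comm d m (suc k) (suc j) T (s≤s j≤k))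
lift-comm d m k j (appl V T) j≤k = cong₂ appl (lift-comm d m k j V j≤k) (lift-comm d m k j T j≤k)
lift-comm d m k j (cast W T) j≤k = cong₂ cast (lift-comm d m k j W j≤k) (lift-comm d m k j T j≤k)

lift-merge : ∀ d m k j T → j ≤ k → k ≤ j + m → lift d k (lift m j T) ≡ lift (m + d) j T
lift-merge d m k j (sort h)   j≤k k≤j+m = refl
lift-merge d m k j (var v)    j≤k k≤j+m = begin
  lift d k (lift m j (var v))        ≡⟨ cong (lift d k) (lift-var m j v) ⟩
  lift d k (var (liftIdx m j v))     ≡⟨ lift-var d k _ ⟩
  var (liftIdx d k (liftIdx m j v))  ≡⟨ cong var (liftIdx-merge d m k j v j≤k k≤j+m) ⟩
  var (liftIdx (m + d) j v)          ≡⟨ lift-var (m + d) j v ⟨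
  lift (m + d) j (var v)             ∎
  where open ≡-Reasoning
lift-merge d m k j (lam W T)  j≤k k≤j+m =
  cong₂ lam (lift-merge d m k j W j≤k k≤j+m) (lift-merge d m (suc k) (suc j) T (s≤s j≤k) (s≤s k≤j+m))
lift-merge d m k j (abbr V T) j≤k k≤j+m =
  cong₂ abbr (lift-merge d m k j V j≤k k≤j+m) (lift-merge d m (suc k) (suc j) T (s≤s j≤k) (s≤s k≤j+m))
lift-merge d m k j (appl V T) j≤k k≤j+m =
  cong₂ appl (lift-merge d m k j V j≤k k≤j+m) (lift-merge d m k j T j≤k k≤j+m)
lift-merge d m k j (cast W T) j≤k k≤j+m =
  cong₂ cast (lift-merge d m k j W j≤k k≤j+m) (lift-merge d m k j T j≤k k≤j+m)

lift-suc-comm : ∀ d k T → lift d (suc k) (lift 1 0 T) ≡ lift 1 0 (lift d k T)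
lift-suc-comm d k T = trans (cong (λ n → lift d n (lift 1 0 T)) (+-comm 1 k)) (lift-comm d 1 k 0 T z≤n)

lift-1-lift : ∀ n V → lift 1 0 (lift (suc n) 0 V) ≡ lift (suc (suc n)) 0 V
lift-1-lift n V = trans (lift-merge 1 (suc n) 0 0 V z≤n z≤n) (cong (λ d → lift (suc d) 0 V) (+-comm n 1))

¬Occurs-lift : ∀ d k j T → k ≤ j → j < k + d → ¬ Occurs j (lift d k T)
¬Occurs-lift d k j (var v) k≤j j<k+d o with subst (Occurs j) (lift-var d k v) o
... | var with v <? k
...   | yes v<k = <⇒≱ (subst (_< k) (sym (liftIdx-< v<k)) v<k) k≤j
...   | no v≮k  = <⇒≱ j<k+d (subst (k + d ≤_) (sym (liftIdx-≥ (≮⇒≥ v≮k))) (+-monoˡ-≤ d (≮⇒≥ v≮k)))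
¬Occurs-lift d k j (lam W T)  k≤j j<k+d (lam₁ o)  = ¬Occurs-lift d k j W k≤j j<k+d o
¬Occurs-lift d k j (lam W T)  k≤j j<k+d (lam₂ o)  = ¬Occurs-lift d (suc k) (suc j) T (s≤s k≤j) (s≤s j<k+d) o
¬Occurs-lift d k j (abbr V T) k≤j j<k+d (abbr₁ o) = ¬Occurs-lift d k j V k≤j j<k+d o
¬Occurs-lift d k j (abbr V T) k≤j j<k+d (abbr₂ o) = ¬Occurs-lift d (suc k) (suc j) T (s≤s k≤j) (s≤s j<k+d) o
¬Occurs-lift d k j (appl V T) k≤j j<k+d (appl₁ o) = ¬Occurs-lift d k j V k≤j j<k+d o
¬Occurs-lift d k j (appl V T) k≤j j<k+d (appl₂ o) = ¬Occurs-lift d k j T k≤j j<k+d o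
¬Occurs-lift d k j (cast W T) k≤j j<k+d (cast₁ o) = ¬Occurs-lift d k j W k≤j j<k+d o
¬Occurs-lift d k j (cast W T) k≤j j<k+d (cast₂ o) = ¬Occurs-lift d k j T k≤j j<k+d o

¬Occurs-lift-suc : ∀ n V → ¬ Occurs n (lift (suc n) 0 V)
¬Occurs-lift-suc n V = ¬Occurs-lift (suc n) 0 n V z≤n ≤-refl

Occurs-lift : ∀ d k {i T} → Occurs i T → Occurs (liftIdx d k i) (lift d k T)
Occurs-lift d k {i} var       = subst (Occurs (liftIdx d k i)) (sym (lift-var d k i)) var
Occurs-lift d k     (lam₁ o)  = lam₁ (Occurs-lift d k o)
Occurs-lift d k {i} (lam₂ o)  = lam₂ (subst (λ j → Occurs j _) (liftIdx-suc d k i) (Occurs-lift d (suc k) o))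
Occurs-lift d k     (abbr₁ o) = abbr₁ (Occurs-lift d k o)
Occurs-lift d k {i} (abbr₂ o) = abbr₂ (subst (λ j → Occurs j _) (liftIdx-suc d k i) (Occurs-lift d (suc k) o))
Occurs-lift d k     (appl₁ o) = appl₁ (Occurs-lift d k o)
Occurs-lift d k     (appl₂ o) = appl₂ (Occurs-lift d k o)
Occurs-lift d k     (cast₁ o) = cast₁ (Occurs-lift d k o)
Occurs-lift d k     (cast₂ o) = cast₂ (Occurs-lift d k o)

Replace-refl : ∀ i V T → Replace i V T T false
Replace-refl i V (sort h)   = sort
Replace-refl i V (var j)    = keep
Replace-refl i V (lam W T)  = lam (Replace-refl i V W) (Replace-refl (suc i) (lift 1 0 V) T)
Replace-refl i V (abbr A T) = abbr (Replace-refl i V A) (Replace-refl (suc i) (lift 1 0 V) T)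
Replace-refl i V (appl A T) = appl (Replace-refl i V A) (Replace-refl i V T)
Replace-refl i V (cast A T) = cast (Replace-refl i V A) (Replace-refl i V T)

Replace-false⇒≡ : ∀ {i V T T' b} → Replace i V T T' b → b ≡ false → T ≡ T'
Replace-false⇒≡ sort        _ = refl
Replace-false⇒≡ keep        _ = refl
Replace-false⇒≡ (lam r s)  b≡f =
  cong₂ lam (Replace-false⇒≡ r (∨-conicalˡ _ _ b≡f)) (Replace-false⇒≡ s (∨-conicalʳ _ _ b≡f))
Replace-false⇒≡ (abbr r s) b≡f =
  cong₂ abbr (Replace-false⇒≡ r (∨-conicalˡ _ _ b≡f)) (Replace-false⇒≡ s (∨-conicalʳ _ _ b≡f))
Replace-false⇒≡ (appl r s) b≡f =
  cong₂ appl (Replace-false⇒≡ r (∨-conicalˡ _ _ b≡f)) (Replace-false⇒≡ s (∨-conicalʳ _ _ b≡f))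
Replace-false⇒≡ (cast r s) b≡f =
  cong₂ cast (Replace-false⇒≡ r (∨-conicalˡ _ _ b≡f)) (Replace-false⇒≡ s (∨-conicalʳ _ _ b≡f))

Replace-true⇒Occurs : ∀ {i V T T' b} → Replace i V T T' b → b ≡ true → Occurs i T
Replace-true⇒Occurs here                     _   = var
Replace-true⇒Occurs (lam  {b₁ = true}  r s)  _   = lam₁  (Replace-true⇒Occurs r refl)
Replace-true⇒Occurs (lam  {b₁ = false} r s)  b≡t = lam₂  (Replace-true⇒Occurs s b≡t)
Replace-true⇒Occurs (abbr {b₁ = true}  r s)  _   = abbr₁ (Replace-true⇒Occurs r refl)
Replace-true⇒Occurs (abbr {b₁ = false} r s)  b≡t = abbr₂ (Replace-true⇒Occurs s b≡t)
Replace-true⇒Occurs (appl {b₁ = true}  r s)  _   = appl₁ (Replace-true⇒Occurs r refl)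
Replace-true⇒Occurs (appl {b₁ = false} r s)  b≡t = appl₂ (Replace-true⇒Occurs s b≡t)
Replace-true⇒Occurs (cast {b₁ = true}  r s)  _   = cast₁ (Replace-true⇒Occurs r refl)
Replace-true⇒Occurs (cast {b₁ = false} r s)  b≡t = cast₂ (Replace-true⇒Occurs s b≡t)

Replace-var : ∀ {i W j T b} → Replace i W (var j) T b → T ≡ var j ⊎ (j ≡ i × T ≡ W)
Replace-var keep = inj₁ refl
Replace-var here = inj₂ (refl , refl)

Replace-lift : ∀ d k {i V T T' b} → Replace i V T T' b →
               Replace (liftIdx d k i) (lift d k V) (lift d k T) (lift d k T') b
Replace-lift d k             sort       = sort
Replace-lift d k             keep       = Replace-refl _ _ _
Replace-lift d k {i} {V}     here       =
  subst (λ T → Replace (liftIdx d k i) (lift d k V) T (lift d k V) true) (sym (lift-var d k i)) here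
Replace-lift d k {i} {V}     (lam r s)  = lam (Replace-lift d k r)
  (subst₂ (λ j X → Replace j X _ _ _) (liftIdx-suc d k i) (lift-suc-comm d k V) (Replace-lift d (suc k) s))
Replace-lift d k {i} {V}     (abbr r s) = abbr (Replace-lift d k r)
  (subst₂ (λ j X → Replace j X _ _ _) (liftIdx-suc d k i) (lift-suc-comm d k V) (Replace-lift d (suc k) s))
Replace-lift d k             (appl r s) = appl (Replace-lift d k r) (Replace-lift d k s)
Replace-lift d k             (cast r s) = cast (Replace-lift d k r) (Replace-lift d k s)

Replace-lift-1 : ∀ {i V T T' b} → Replace i V T T' b → Replace (suc i) (lift 1 0 V) (lift 1 0 T) (lift 1 0 T') b
Replace-lift-1 {i} {V} {T} {T'} {b} r =
  subst (λ j → Replace j (lift 1 0 V) (lift 1 0 T) (lift 1 0 T') b) (+-comm i 1) (Replace-lift 1 0 r)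

→₀-lift : ∀ d k {T T'} → T →₀ T' → lift d k T →₀ lift d k T'
→₀-lift d k refl       = refl
→₀-lift d k (lam p q)  = lam (→₀-lift d k p) (→₀-lift d (suc k) q)
→₀-lift d k (abbr p q) = abbr (→₀-lift d k p) (→₀-lift d (suc k) q)
→₀-lift d k (appl p q) = appl (→₀-lift d k p) (→₀-lift d k q)
→₀-lift d k (cast p q) = cast (→₀-lift d k p) (→₀-lift d k q)
→₀-lift d k (β p q)    = β (→₀-lift d k p) (→₀-lift d (suc k) q)
→₀-lift d k (δ {V₂ = V₂} p q (_ , o , r)) = δ (→₀-lift d k p) (→₀-lift d (suc k) q)
  ( ¬Occurs-lift-suc 0 (lift d k V₂)
  , Occurs-lift d (suc k) o
  , subst (λ X → Replace 0 X _ _ true) (lift-suc-comm d k V₂) (Replace-lift d (suc k) r))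
→₀-lift d k (ζ {T₁' = T₁'} {T₂ = T₂} refl q refl) =
  ζ {T₁' = lift d k T₁'} (lift-suc-comm d k T₁') (→₀-lift d (suc k) q) (lift-suc-comm d k T₂)
→₀-lift d k (τ p)      = τ (→₀-lift d k p)
→₀-lift d k (υ {V₃ = V₃} {V₄ = V₄} {T₂ = T₂} p q r) =
  subst (λ X → _ →₀ abbr (lift d k V₄) (appl X (lift d (suc k) T₂))) (sym (lift-suc-comm d k V₃))
    (υ (→₀-lift d k p) (→₀-lift d k q) (→₀-lift d (suc k) r))

Replace-commute : ∀ {m W X Y b₀ p Z W' b} → Replace m W X Y b₀ → Replace p Z W W' b →
                  Σ[ Y' ∈ Term ] Σ[ b' ∈ Bool ] Replace m W' X Y' b₀ × Replace p Z Y Y' b'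
Replace-commute         sort       r = _ , false , sort , sort
Replace-commute         keep       r = _ , false , keep , keep
Replace-commute {b = b} here       r = _ , b , here , r
Replace-commute (lam s₁ s₂) r with Replace-commute s₁ r | Replace-commute s₂ (Replace-lift-1 r)
... | _ , c₁ , t₁ , u₁ | _ , c₂ , t₂ , u₂ = _ , c₁ ∨ c₂ , lam t₁ t₂ , lam u₁ u₂
Replace-commute (abbr s₁ s₂) r with Replace-commute s₁ r | Replace-commute s₂ (Replace-lift-1 r)
... | _ , c₁ , t₁ , u₁ | _ , c₂ , t₂ , u₂ = _ , c₁ ∨ c₂ , abbr t₁ t₂ , abbr u₁ u₂
Replace-commute (appl s₁ s₂) r with Replace-commute s₁ r | Replace-commute s₂ r
... | _ , c₁ , t₁ , u₁ | _ , c₂ , t₂ , u₂ = _ , c₁ ∨ c₂ , appl t₁ t₂ , appl u₁ u₂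
Replace-commute (cast s₁ s₂) r with Replace-commute s₁ r | Replace-commute s₂ r
... | _ , c₁ , t₁ , u₁ | _ , c₂ , t₂ , u₂ = _ , c₁ ∨ c₂ , cast t₁ t₂ , cast u₁ u₂

item : Item → Env → Env
item λ[ W ] C = lam W C
item δ[ V ] C = abbr V C

plug-assoc : ∀ A B C → plug (plug A B) C ≡ plug A (plug B C)
plug-assoc (sort h)   B C = refl
plug-assoc (lam W A)  B C = cong (lam W) (plug-assoc A B C)
plug-assoc (abbr V A) B C = cong (abbr V) (plug-assoc A B C)
plug-assoc (appl V A) B C = cong (appl V) (plug-assoc A B C)
plug-assoc (cast W A) B C = cong (cast W) (plug-assoc A B C)

plug-item : ∀ it A B → plug (item it A) B ≡ item it (plug A B)
plug-item λ[ W ] A B = refl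
plug-item δ[ V ] A B = refl

plug-terminal : ∀ A → plug A (sort (terminal A)) ≡ A
plug-terminal (sort h)   = refl
plug-terminal (lam W A)  = cong (lam W) (plug-terminal A)
plug-terminal (abbr V A) = cong (abbr V) (plug-terminal A)
plug-terminal (appl V A) = cong (appl V) (plug-terminal A)
plug-terminal (cast W A) = cong (cast W) (plug-terminal A)

terminal-plug : ∀ A B → terminal (plug A B) ≡ terminal B
terminal-plug (sort h)   B = refl
terminal-plug (lam W A)  B = terminal-plug A B
terminal-plug (abbr V A) B = terminal-plug A B
terminal-plug (appl V A) B = terminal-plug A B
terminal-plug (cast W A) B = terminal-plug A B

binders-plug : ∀ A B → binders (plug A B) ≡ binders A + binders B
binders-plug (sort h)   B = refl
binders-plug (lam W A)  B = cong suc (binders-plug A B)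
binders-plug (abbr V A) B = cong suc (binders-plug A B)
binders-plug (appl V A) B = binders-plug A B
binders-plug (cast W A) B = binders-plug A B

binders-plug-cong : ∀ A {B B'} → binders B ≡ binders B' → binders (plug A B) ≡ binders (plug A B')
binders-plug-cong A {B} {B'} eq = trans (binders-plug A B) (trans (cong (binders A +_) eq) (sym (binders-plug A B')))

binders-item : ∀ it C → binders (item it C) ≡ suc (binders C)
binders-item λ[ W ] C = refl
binders-item δ[ V ] C = refl

binders-plug-item : ∀ A it C → binders (plug A (item it C)) ≡ binders A + suc (binders C)
binders-plug-item A it C = trans (binders-plug A (item it C)) (cong (binders A +_) (binders-item it C))

binders-<-plug-item : ∀ A it C → binders C < binders (plug A (item it C))
binders-<-plug-item A it C =
  subst (binders C <_) (sym (binders-plug-item A it C)) (m≤n+m (suc (binders C)) (binders A))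

,δ-plug : ∀ A B X → plug A B ,δ X ≡ plug A (B ,δ X)
,δ-plug A B X = trans (plug-assoc A B _) (cong (λ h → plug A (plug B (abbr X (sort h)))) (terminal-plug A B))

,λ-plug : ∀ A B X → plug A B ,λ X ≡ plug A (B ,λ X)
,λ-plug A B X = trans (plug-assoc A B _) (cong (λ h → plug A (plug B (lam X (sort h)))) (terminal-plug A B))

binders-,δ : ∀ G X → binders (G ,δ X) ≡ suc (binders G)
binders-,δ G X = trans (binders-plug G _) (+-comm (binders G) 1)

binders-,λ : ∀ G X → binders (G ,λ X) ≡ suc (binders G)
binders-,λ G X = trans (binders-plug G _) (+-comm (binders G) 1)

lam-injective : ∀ {W W' A B} → Env.lam W A ≡ lam W' B → W ≡ W' × A ≡ B
lam-injective refl = refl , refl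

abbr-injective : ∀ {V V' A B} → Env.abbr V A ≡ abbr V' B → V ≡ V' × A ≡ B
abbr-injective refl = refl , refl

appl-injective : ∀ {V V' A B} → Env.appl V A ≡ appl V' B → V ≡ V' × A ≡ B
appl-injective refl = refl , refl

cast-injective : ∀ {W W' A B} → Env.cast W A ≡ cast W' B → W ≡ W' × A ≡ B
cast-injective refl = refl , refl

data Located (C₁ : Env) (it : Item) (C₂ E G : Env) : Set where
  in-suffix : ∀ Y → C₁ ≡ plug E Y → G ≡ plug Y (item it C₂) → Located C₁ it C₂ E G
  in-prefix : ∀ B → E ≡ plug C₁ (item it B) → C₂ ≡ plug B G → Located C₁ it C₂ E G

locate : ∀ C₁ it C₂ E G → plug C₁ (item it C₂) ≡ plug E G → Located C₁ it C₂ E G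
locate C₁ it C₂ (sort h) G e = in-suffix C₁ refl (sym e)
locate (sort h) λ[ W ] C₂ (lam W' E)  G refl = in-prefix E refl refl
locate (sort h) δ[ V ] C₂ (abbr V' E) G refl = in-prefix E refl refl
locate (sort h) λ[ W ] C₂ (abbr V E)  G ()
locate (sort h) λ[ W ] C₂ (appl V E)  G ()
locate (sort h) λ[ W ] C₂ (cast V E)  G ()
locate (sort h) δ[ V ] C₂ (lam W E)   G ()
locate (sort h) δ[ V ] C₂ (appl W E)  G ()
locate (sort h) δ[ V ] C₂ (cast W E)  G ()
locate (lam W C₁) it C₂ (lam W' E) G e with lam-injective e
... | refl , e' with locate C₁ it C₂ E G e'
...   | in-suffix Y p q = in-suffix Y (cong (lam W) p) q
...   | in-prefix B p q = in-prefix B (cong (lam W) p) q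
locate (abbr V C₁) it C₂ (abbr V' E) G e with abbr-injective e
... | refl , e' with locate C₁ it C₂ E G e'
...   | in-suffix Y p q = in-suffix Y (cong (abbr V) p) q
...   | in-prefix B p q = in-prefix B (cong (abbr V) p) q
locate (appl V C₁) it C₂ (appl V' E) G e with appl-injective e
... | refl , e' with locate C₁ it C₂ E G e'
...   | in-suffix Y p q = in-suffix Y (cong (appl V) p) q
...   | in-prefix B p q = in-prefix B (cong (appl V) p) q
locate (cast W C₁) it C₂ (cast W' E) G e with cast-injective e
... | refl , e' with locate C₁ it C₂ E G e'
...   | in-suffix Y p q = in-suffix Y (cong (cast W) p) q
...   | in-prefix B p q = in-prefix B (cong (cast W) p) q
locate (lam _ _)  it C₂ (abbr _ _) G ()
locate (lam _ _)  it C₂ (appl _ _) G ()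
locate (lam _ _)  it C₂ (cast _ _) G ()
locate (abbr _ _) it C₂ (lam _ _)  G ()
locate (abbr _ _) it C₂ (appl _ _) G ()
locate (abbr _ _) it C₂ (cast _ _) G ()
locate (appl _ _) it C₂ (lam _ _)  G ()
locate (appl _ _) it C₂ (abbr _ _) G ()
locate (appl _ _) it C₂ (cast _ _) G ()
locate (cast _ _) it C₂ (lam _ _)  G ()
locate (cast _ _) it C₂ (abbr _ _) G ()
locate (cast _ _) it C₂ (appl _ _) G ()

liftEnv : ℕ → ℕ → Env → Env
liftEnv d k (sort h)   = sort h
liftEnv d k (lam W G)  = lam (lift d k W) (liftEnv d (suc k) G)
liftEnv d k (abbr V G) = abbr (lift d k V) (liftEnv d (suc k) G)
liftEnv d k (appl V G) = appl (lift d k V) (liftEnv d k G)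
liftEnv d k (cast W G) = cast (lift d k W) (liftEnv d k G)

liftItem : ℕ → ℕ → Item → Item
liftItem d k λ[ W ] = λ[ lift d k W ]
liftItem d k δ[ V ] = δ[ lift d k V ]

liftEnv-item : ∀ d k it C → liftEnv d k (item it C) ≡ item (liftItem d k it) (liftEnv d (suc k) C)
liftEnv-item d k λ[ W ] C = refl
liftEnv-item d k δ[ V ] C = refl

liftEnv-plug : ∀ d k A B → liftEnv d k (plug A B) ≡ plug (liftEnv d k A) (liftEnv d (k + binders A) B)
liftEnv-plug d k (sort h)   B = cong (λ n → liftEnv d n B) (sym (+-identityʳ k))
liftEnv-plug d k (lam W A)  B = cong (lam (lift d k W))
  (trans (liftEnv-plug d (suc k) A B) (cong (λ n → plug (liftEnv d (suc k) A) (liftEnv d n B)) (sym (+-suc k (binders A)))))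
liftEnv-plug d k (abbr V A) B = cong (abbr (lift d k V))
  (trans (liftEnv-plug d (suc k) A B) (cong (λ n → plug (liftEnv d (suc k) A) (liftEnv d n B)) (sym (+-suc k (binders A)))))
liftEnv-plug d k (appl V A) B = cong (appl (lift d k V)) (liftEnv-plug d k A B)
liftEnv-plug d k (cast W A) B = cong (cast (lift d k W)) (liftEnv-plug d k A B)

binders-liftEnv : ∀ d k G → binders (liftEnv d k G) ≡ binders G
binders-liftEnv d k (sort h)   = refl
binders-liftEnv d k (lam W G)  = cong suc (binders-liftEnv d (suc k) G)
binders-liftEnv d k (abbr V G) = cong suc (binders-liftEnv d (suc k) G)
binders-liftEnv d k (appl V G) = binders-liftEnv d k G
binders-liftEnv d k (cast W G) = binders-liftEnv d k G

terminal-liftEnv : ∀ d k G → terminal (liftEnv d k G) ≡ terminal G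
terminal-liftEnv d k (sort h)   = refl
terminal-liftEnv d k (lam W G)  = terminal-liftEnv d (suc k) G
terminal-liftEnv d k (abbr V G) = terminal-liftEnv d (suc k) G
terminal-liftEnv d k (appl V G) = terminal-liftEnv d k G
terminal-liftEnv d k (cast W G) = terminal-liftEnv d k G

liftEnv-,δ : ∀ d k G V → liftEnv d k (G ,δ V) ≡ liftEnv d k G ,δ lift d (k + binders G) V
liftEnv-,δ d k G V = trans (liftEnv-plug d k G _)
  (cong (λ h → plug (liftEnv d k G) (abbr (lift d (k + binders G) V) (sort h))) (sym (terminal-liftEnv d k G)))

liftEnv-,λ : ∀ d k G W → liftEnv d k (G ,λ W) ≡ liftEnv d k G ,λ lift d (k + binders G) W
liftEnv-,λ d k G W = trans (liftEnv-plug d k G _)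
  (cong (λ h → plug (liftEnv d k G) (lam (lift d (k + binders G) W) (sort h))) (sym (terminal-liftEnv d k G)))

insert : Env → Env → Env → Env
insert F E G = plug (plug E F) (liftEnv (binders F) 0 G)

insert-,δ : ∀ F E G V → insert F E (G ,δ V) ≡ insert F E G ,δ lift (binders F) (binders G) V
insert-,δ F E G V =
  trans (cong (plug (plug E F)) (liftEnv-,δ (binders F) 0 G V)) (sym (,δ-plug (plug E F) (liftEnv (binders F) 0 G) _))

insert-,λ : ∀ F E G W → insert F E (G ,λ W) ≡ insert F E G ,λ lift (binders F) (binders G) W
insert-,λ F E G W =
  trans (cong (plug (plug E F)) (liftEnv-,λ (binders F) 0 G W)) (sym (,λ-plug (plug E F) (liftEnv (binders F) 0 G) _))

data Shifted (F E G C₁ : Env) (it : Item) (C₂ : Env) : Set where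
  in-suffix : ∀ Y {C₂'} → C₁ ≡ plug E Y →
              insert F E G ≡ plug (insert F E Y) (item (liftItem (binders F) (binders Y) it) C₂') →
              binders C₂' ≡ liftIdx (binders F) (binders G) (binders C₂) →
              (∀ W → lift (suc (binders C₂')) 0 (lift (binders F) (binders Y) W)
                       ≡ lift (binders F) (binders G) (lift (suc (binders C₂)) 0 W)) →
              Shifted F E G C₁ it C₂
  in-prefix : ∀ {C₂'} → insert F E G ≡ plug C₁ (item it C₂') →
              binders C₂' ≡ liftIdx (binders F) (binders G) (binders C₂) →
              (∀ W → lift (suc (binders C₂')) 0 W ≡ lift (binders F) (binders G) (lift (suc (binders C₂)) 0 W)) →
              Shifted F E G C₁ it C₂

insert-plug-item : ∀ F E Y it C →
                   insert F E (plug Y (item it C))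
                   ≡ plug (insert F E Y) (item (liftItem (binders F) (binders Y) it) (liftEnv (binders F) (suc (binders Y)) C))
insert-plug-item F E Y it C = begin
  plug (plug E F) (liftEnv d 0 (plug Y (item it C)))
    ≡⟨ cong (plug (plug E F)) (liftEnv-plug d 0 Y (item it C)) ⟩
  plug (plug E F) (plug (liftEnv d 0 Y) (liftEnv d (binders Y) (item it C)))
    ≡⟨ cong (λ X → plug (plug E F) (plug (liftEnv d 0 Y) X)) (liftEnv-item d (binders Y) it C) ⟩
  plug (plug E F) (plug (liftEnv d 0 Y) (item (liftItem d (binders Y) it) (liftEnv d (suc (binders Y)) C)))
    ≡⟨ plug-assoc (plug E F) (liftEnv d 0 Y) _ ⟨
  plug (insert F E Y) (item (liftItem d (binders Y) it) (liftEnv d (suc (binders Y)) C)) ∎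
  where
  open ≡-Reasoning
  d = binders F

insert-plug-prefix : ∀ F C₁ it B G →
                     insert F (plug C₁ (item it B)) G ≡ plug C₁ (item it (plug B (plug F (liftEnv (binders F) 0 G))))
insert-plug-prefix F C₁ it B G = begin
  plug (plug (plug C₁ (item it B)) F) L  ≡⟨ plug-assoc (plug C₁ (item it B)) F L ⟩
  plug (plug C₁ (item it B)) (plug F L)  ≡⟨ plug-assoc C₁ (item it B) (plug F L) ⟩
  plug C₁ (plug (item it B) (plug F L))  ≡⟨ cong (plug C₁) (plug-item it B (plug F L)) ⟩
  plug C₁ (item it (plug B (plug F L)))  ∎
  where
  open ≡-Reasoning
  L = liftEnv (binders F) 0 G

shift-item : ∀ F {E G C₁ it C₂} → plug C₁ (item it C₂) ≡ plug E G → Shifted F E G C₁ it C₂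
shift-item F {E} {G} {C₁} {it} {C₂} e with locate C₁ it C₂ E G e
... | in-suffix Y refl refl = in-suffix Y refl (insert-plug-item F E Y it C₂) idx ty
  where
  d = binders F
  n = binders C₂
  G≡ : binders (plug Y (item it C₂)) ≡ binders Y + suc n
  G≡ = binders-plug-item Y it C₂

  idx : binders (liftEnv d (suc (binders Y)) C₂) ≡ liftIdx d (binders (plug Y (item it C₂))) n
  idx = trans (binders-liftEnv d _ C₂)
    (sym (trans (cong (λ k → liftIdx d k n) G≡) (liftIdx-< (m≤n+m (suc n) (binders Y)))))

  ty : ∀ W → lift (suc (binders (liftEnv d (suc (binders Y)) C₂))) 0 (lift d (binders Y) W)
           ≡ lift d (binders (plug Y (item it C₂))) (lift (suc n) 0 W)
  ty W = trans (cong (λ k → lift (suc k) 0 (lift d (binders Y) W)) (binders-liftEnv d _ C₂))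
    (sym (trans (cong (λ k → lift d k (lift (suc n) 0 W)) G≡) (lift-comm d (suc n) (binders Y) 0 W z≤n)))
... | in-prefix B refl refl = in-prefix (insert-plug-prefix F C₁ it B G) idx ty
  where
  d = binders F
  n = binders (plug B G)
  C₂' = plug B (plug F (liftEnv d 0 G))

  C₂'≡ : binders C₂' ≡ n + d
  C₂'≡ = begin
    binders C₂'                                  ≡⟨ binders-plug B _ ⟩
    binders B + binders (plug F (liftEnv d 0 G)) ≡⟨ cong (binders B +_) (binders-plug F _) ⟩
    binders B + (d + binders (liftEnv d 0 G))    ≡⟨ cong (λ k → binders B + (d + k)) (binders-liftEnv d 0 G) ⟩
    binders B + (d + binders G)                  ≡⟨ cong (binders B +_) (+-comm d (binders G)) ⟩
    binders B + (binders G + d)                  ≡⟨ +-assoc (binders B) (binders G) d ⟨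
    binders B + binders G + d                    ≡⟨ cong (_+ d) (binders-plug B G) ⟨
    n + d                                        ∎
    where open ≡-Reasoning

  G≤n : binders G ≤ n
  G≤n = subst (binders G ≤_) (sym (binders-plug B G)) (m≤n+m (binders G) (binders B))

  idx : binders C₂' ≡ liftIdx d (binders G) n
  idx = trans C₂'≡ (sym (liftIdx-≥ G≤n))

  ty : ∀ W → lift (suc (binders C₂')) 0 W ≡ lift d (binders G) (lift (suc n) 0 W)
  ty W = trans (cong (λ k → lift (suc k) 0 W) C₂'≡)
    (sym (lift-merge d (suc n) (binders G) 0 W z≤n (m≤n⇒m≤1+n G≤n)))

:=⁺-lift : ∀ d k V V' {n n' T T'} → T [ n :=⁺ lift (suc n) 0 V ] T' → n' ≡ liftIdx d k n →
           lift (suc n') 0 V' ≡ lift d k (lift (suc n) 0 V) →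
           lift d k T [ n' :=⁺ lift (suc n') 0 V' ] lift d k T'
:=⁺-lift d k V V' {n} {T = T} {T'} (_ , o , r) refl V'≡ =
  ¬Occurs-lift-suc _ V' , Occurs-lift d k o ,
  subst (λ X → Replace (liftIdx d k n) X (lift d k T) (lift d k T') true) (sym V'≡) (Replace-lift d k r)

lift-var-⊢ : ∀ d k {Γ g n n' U U'} → Γ ⊢[ g ] var n' ∶ U' → n' ≡ liftIdx d k n → U' ≡ U →
             Γ ⊢[ g ] lift d k (var n) ∶ U
lift-var-⊢ d k {n = n} t refl refl = subst (λ X → _ ⊢[ _ ] X ∶ _) (sym (lift-var d k n)) t

⊢-var-cong : ∀ W {Γ g m n} → m ≡ n → Γ ⊢[ g ] var m ∶ lift (suc m) 0 W → Γ ⊢[ g ] var n ∶ lift (suc n) 0 W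
⊢-var-cong W refl t = t

weaken-⟶ : ∀ {Γ X Y} → Γ ⊢ X ⟶ Y → ∀ E G F → Γ ≡ plug E G →
           insert F E G ⊢ lift (binders F) (binders G) X ⟶ lift (binders F) (binders G) Y
weaken-⟶ (free p) E G F _ = free (→₀-lift _ _ p)
weaken-⟶ (unfold {C₁} {V} {C₂} e p s) E G F e' with shift-item F {E} {G} {C₁} {δ[ V ]} {C₂} (trans (sym e) e')
... | in-suffix Y _ eqΓ idx ty = unfold eqΓ (→₀-lift _ _ p)
  (:=⁺-lift (binders F) (binders G) V (lift (binders F) (binders Y) V) s idx (ty V))
... | in-prefix eqΓ idx ty     = unfold eqΓ (→₀-lift _ _ p)
  (:=⁺-lift (binders F) (binders G) V V s idx (ty V))

weaken-⇔ : ∀ {Γ X Y} → Γ ⊢ X ⇔ Y → ∀ E G F → Γ ≡ plug E G →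
           insert F E G ⊢ lift (binders F) (binders G) X ⇔ lift (binders F) (binders G) Y
weaken-⇔ (step s)        E G F e = step (weaken-⟶ s E G F e)
weaken-⇔ (⇔-sym c)       E G F e = ⇔-sym (weaken-⇔ c E G F e)
weaken-⇔ (⇔-trans c₁ c₂) E G F e = ⇔-trans (weaken-⇔ c₁ E G F e) (weaken-⇔ c₂ E G F e)

-- The abbr/abst premises extend the environment at its end, so weakening at the end alone
-- would not survive the induction.
weaken : ∀ {Γ g T U} → Γ ⊢[ g ] T ∶ U → ∀ E G F → Γ ≡ plug E G →
         insert F E G ⊢[ g ] lift (binders F) (binders G) T ∶ lift (binders F) (binders G) U
weaken sort E G F _ = sort
weaken (def {C₁ = C₁} {V} {C₂} {W} e t) E G F e' with shift-item F {E} {G} {C₁} {δ[ V ]} {C₂} (trans (sym e) e')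
... | in-suffix Y p eqΓ idx ty = lift-var-⊢ (binders F) (binders G) (def eqΓ (weaken t E Y F p)) idx (ty W)
... | in-prefix eqΓ idx ty     = lift-var-⊢ (binders F) (binders G) (def eqΓ t) idx (ty W)
weaken (decl {C₁ = C₁} {W} {C₂} e t) E G F e' with shift-item F {E} {G} {C₁} {λ[ W ]} {C₂} (trans (sym e) e')
... | in-suffix Y p eqΓ idx ty = lift-var-⊢ (binders F) (binders G) (decl eqΓ (weaken t E Y F p)) idx (ty W)
... | in-prefix eqΓ idx ty     = lift-var-⊢ (binders F) (binders G) (decl eqΓ t) idx (ty W)
weaken {g = g} (abbr {V = V} {T = T} {U} tV tT) E G F refl = abbr (weaken tV E G F refl)
  (subst₂ (λ Γ k → Γ ⊢[ g ] lift (binders F) k T ∶ lift (binders F) k U) (insert-,δ F E G V) (binders-,δ G V)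
    (weaken tT E (G ,δ V) F (,δ-plug E G V)))
weaken {g = g} (abst {W = W} {T = T} {U = U} tW tT) E G F refl = abst (weaken tW E G F refl)
  (subst₂ (λ Γ k → Γ ⊢[ g ] lift (binders F) k T ∶ lift (binders F) k U) (insert-,λ F E G W) (binders-,λ G W)
    (weaken tT E (G ,λ W) F (,λ-plug E G W)))
weaken (appl tV tT)   E G F e = appl (weaken tV E G F e) (weaken tT E G F e)
weaken (cast tT tW)   E G F e = cast (weaken tT E G F e) (weaken tW E G F e)
weaken (conv tU tT c) E G F e = conv (weaken tU E G F e) (weaken tT E G F e) (weaken-⇔ c E G F e)

binders-plug-sort : ∀ C h → binders (plug C (sort h)) ≡ binders C
binders-plug-sort C h = trans (binders-plug C (sort h)) (+-identityʳ _)

,δ-plug-sort : ∀ Γ V h → plug (Γ ,δ V) (sort h) ≡ plug Γ (sort h) ,δ V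
,δ-plug-sort Γ V h = trans (plug-assoc Γ _ (sort h)) (sym (,δ-plug Γ (sort h) V))

,λ-plug-sort : ∀ Γ W h → plug (Γ ,λ W) (sort h) ≡ plug Γ (sort h) ,λ W
,λ-plug-sort Γ W h = trans (plug-assoc Γ _ (sort h)) (sym (,λ-plug Γ (sort h) W))

⟶-terminal-irrelevant : ∀ {Γ X Y} → Γ ⊢ X ⟶ Y → ∀ h → plug Γ (sort h) ⊢ X ⟶ Y
⟶-terminal-irrelevant (free p) h = free p
⟶-terminal-irrelevant (unfold {C₁} {V} {C₂} refl p s) h =
  unfold (plug-assoc C₁ (abbr V C₂) (sort h)) p
    (subst (λ n → _ [ n :=⁺ lift (suc n) 0 V ] _) (sym (binders-plug-sort C₂ h)) s)

⇔-terminal-irrelevant : ∀ {Γ X Y} → Γ ⊢ X ⇔ Y → ∀ h → plug Γ (sort h) ⊢ X ⇔ Y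
⇔-terminal-irrelevant (step s)        h = step (⟶-terminal-irrelevant s h)
⇔-terminal-irrelevant (⇔-sym c)       h = ⇔-sym (⇔-terminal-irrelevant c h)
⇔-terminal-irrelevant (⇔-trans c₁ c₂) h = ⇔-trans (⇔-terminal-irrelevant c₁ h) (⇔-terminal-irrelevant c₂ h)

⊢-terminal-irrelevant : ∀ {Γ g T U} → Γ ⊢[ g ] T ∶ U → ∀ h → plug Γ (sort h) ⊢[ g ] T ∶ U
⊢-terminal-irrelevant sort h = sort
⊢-terminal-irrelevant (def {C₁ = C₁} {V} {C₂} {W} refl t) h =
  ⊢-var-cong W (binders-plug-sort C₂ h) (def (plug-assoc C₁ (abbr V C₂) (sort h)) t)
⊢-terminal-irrelevant (decl {C₁ = C₁} {W} {C₂} refl t) h =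
  ⊢-var-cong W (binders-plug-sort C₂ h) (decl (plug-assoc C₁ (lam W C₂) (sort h)) t)
⊢-terminal-irrelevant {Γ} {g} (abbr {V = V} {T = T} {U} tV tT) h =
  abbr (⊢-terminal-irrelevant tV h)
       (subst (λ Δ → Δ ⊢[ g ] T ∶ U) (,δ-plug-sort Γ V h) (⊢-terminal-irrelevant tT h))
⊢-terminal-irrelevant {Γ} {g} (abst {W = W} {T = T} {U = U} tW tT) h =
  abst (⊢-terminal-irrelevant tW h)
       (subst (λ Δ → Δ ⊢[ g ] T ∶ U) (,λ-plug-sort Γ W h) (⊢-terminal-irrelevant tT h))
⊢-terminal-irrelevant (appl tV tT)   h = appl (⊢-terminal-irrelevant tV h) (⊢-terminal-irrelevant tT h)
⊢-terminal-irrelevant (cast tT tW)   h = cast (⊢-terminal-irrelevant tT h) (⊢-terminal-irrelevant tW h)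
⊢-terminal-irrelevant (conv tU tT c) h =
  conv (⊢-terminal-irrelevant tU h) (⊢-terminal-irrelevant tT h) (⇔-terminal-irrelevant c h)

⊢-extend : ∀ {C g T U} → C ⊢[ g ] T ∶ U → ∀ F → plug C F ⊢[ g ] lift (binders F) 0 T ∶ lift (binders F) 0 U
⊢-extend {C} {g} {T} {U} t F = subst (λ Γ → Γ ⊢[ g ] lift (binders F) 0 T ∶ lift (binders F) 0 U) env
  (⊢-terminal-irrelevant (weaken t C (sort (terminal C)) F (sym (plug-terminal C))) (terminal F))
  where
  env : plug (insert F C (sort (terminal C))) (sort (terminal F)) ≡ plug C F
  env = begin
    plug (plug (plug C F) (sort (terminal C))) (sort (terminal F))  ≡⟨ plug-assoc (plug C F) _ _ ⟩
    plug (plug C F) (sort (terminal F))                              ≡⟨ plug-assoc C F _ ⟩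
    plug C (plug F (sort (terminal F)))                              ≡⟨ cong (plug C) (plug-terminal F) ⟩
    plug C F                                                         ∎
    where open ≡-Reasoning

⊢-lam-inv : ∀ {Γ g W U K} → Γ ⊢[ g ] lam W U ∶ K →
            ∃ λ V → ∃ λ K' → Γ ⊢[ g ] W ∶ V × (Γ ,λ W) ⊢[ g ] U ∶ K'
⊢-lam-inv (abst tW tU) = _ , _ , tW , tU
⊢-lam-inv (conv _ t _) = ⊢-lam-inv t

⊢-valid : ∀ {Γ g T U} → Γ ⊢[ g ] T ∶ U → ∃ λ K → Γ ⊢[ g ] U ∶ K
⊢-valid sort = _ , sort
⊢-valid (def {V = V} {C₂ = C₂} refl t) = _ , ⊢-extend (proj₂ (⊢-valid t)) (abbr V C₂)
⊢-valid (decl {W = W} {C₂ = C₂} refl t) = _ , ⊢-extend t (lam W C₂)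
⊢-valid (abbr tV tT) = _ , abbr tV (proj₂ (⊢-valid tT))
⊢-valid (abst tW tT) = _ , abst tW (proj₂ (⊢-valid tT))
⊢-valid (appl tV tT) with ⊢-lam-inv (proj₂ (⊢-valid tT))
... | _ , _ , tW , tU = _ , appl tV (abst tW tU)
⊢-valid (cast tT tW) = _ , cast tW (proj₂ (⊢-valid tW))
⊢-valid (conv tU _ _) = _ , tU

-- k is the index of the δ-bound variable at the head of G; appl/cast items bind nothing and stay fixed.
data ReplaceEnv (V : Term) : ℕ → Env → Env → Set where
  sort : ∀ {k h} → ReplaceEnv V k (sort h) (sort h)
  lam  : ∀ {k W W' G G' b} → Replace k (lift (suc k) 0 V) W W' b → ReplaceEnv V (suc k) G G' →
         ReplaceEnv V k (lam W G) (lam W' G')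
  abbr : ∀ {k X X' G G' b} → Replace k (lift (suc k) 0 V) X X' b → ReplaceEnv V (suc k) G G' →
         ReplaceEnv V k (abbr X G) (abbr X' G')
  appl : ∀ {k X G G'} → ReplaceEnv V k G G' → ReplaceEnv V k (appl X G) (appl X G')
  cast : ∀ {k W G G'} → ReplaceEnv V k G G' → ReplaceEnv V k (cast W G) (cast W G')

ReplaceEnv-refl : ∀ {V} k G → ReplaceEnv V k G G
ReplaceEnv-refl k (sort h)   = sort
ReplaceEnv-refl k (lam W G)  = lam (Replace-refl _ _ W) (ReplaceEnv-refl (suc k) G)
ReplaceEnv-refl k (abbr X G) = abbr (Replace-refl _ _ X) (ReplaceEnv-refl (suc k) G)
ReplaceEnv-refl k (appl X G) = appl (ReplaceEnv-refl k G)
ReplaceEnv-refl k (cast W G) = cast (ReplaceEnv-refl k G)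

ReplaceEnv-binders : ∀ {V k G G'} → ReplaceEnv V k G G' → binders G ≡ binders G'
ReplaceEnv-binders sort       = refl
ReplaceEnv-binders (lam _ ρ)  = cong suc (ReplaceEnv-binders ρ)
ReplaceEnv-binders (abbr _ ρ) = cong suc (ReplaceEnv-binders ρ)
ReplaceEnv-binders (appl ρ)   = ReplaceEnv-binders ρ
ReplaceEnv-binders (cast ρ)   = ReplaceEnv-binders ρ

ReplaceEnv-terminal : ∀ {V k G G'} → ReplaceEnv V k G G' → terminal G ≡ terminal G'
ReplaceEnv-terminal sort       = refl
ReplaceEnv-terminal (lam _ ρ)  = ReplaceEnv-terminal ρ
ReplaceEnv-terminal (abbr _ ρ) = ReplaceEnv-terminal ρ
ReplaceEnv-terminal (appl ρ)   = ReplaceEnv-terminal ρ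
ReplaceEnv-terminal (cast ρ)   = ReplaceEnv-terminal ρ

ReplaceEnv-plug : ∀ {V k A A' B B'} → ReplaceEnv V k A A' → ReplaceEnv V (k + binders A) B B' →
                  ReplaceEnv V k (plug A B) (plug A' B')
ReplaceEnv-plug {V} {k} sort ρB = subst (λ n → ReplaceEnv V n _ _) (+-identityʳ k) ρB
ReplaceEnv-plug {V} {k} {lam W A}  {B = B} {B'} (lam r ρA)  ρB =
  lam r (ReplaceEnv-plug ρA (subst (λ n → ReplaceEnv V n B B') (+-suc k (binders A)) ρB))
ReplaceEnv-plug {V} {k} {abbr X A} {B = B} {B'} (abbr r ρA) ρB =
  abbr r (ReplaceEnv-plug ρA (subst (λ n → ReplaceEnv V n B B') (+-suc k (binders A)) ρB))
ReplaceEnv-plug (appl ρA) ρB = appl (ReplaceEnv-plug ρA ρB)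
ReplaceEnv-plug (cast ρA) ρB = cast (ReplaceEnv-plug ρA ρB)

ReplaceEnv-split : ∀ {V k} A {B Z} → ReplaceEnv V k (plug A B) Z →
                   Σ[ A' ∈ Env ] Σ[ B' ∈ Env ] Z ≡ plug A' B' × ReplaceEnv V k A A' × ReplaceEnv V (k + binders A) B B'
ReplaceEnv-split {V} {k} (sort h) {B} {Z} ρ =
  sort h , Z , refl , sort , subst (λ n → ReplaceEnv V n B Z) (sym (+-identityʳ k)) ρ
ReplaceEnv-split {V} {k} (lam W A) {B} (lam r ρ) with ReplaceEnv-split A ρ
... | A' , B' , refl , ρA , ρB =
  lam _ A' , B' , refl , lam r ρA , subst (λ n → ReplaceEnv V n B B') (sym (+-suc k (binders A))) ρB
ReplaceEnv-split {V} {k} (abbr X A) {B} (abbr r ρ) with ReplaceEnv-split A ρ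
... | A' , B' , refl , ρA , ρB =
  abbr _ A' , B' , refl , abbr r ρA , subst (λ n → ReplaceEnv V n B B') (sym (+-suc k (binders A))) ρB
ReplaceEnv-split (appl X A) (appl ρ) with ReplaceEnv-split A ρ
... | A' , B' , refl , ρA , ρB = appl X A' , B' , refl , appl ρA , ρB
ReplaceEnv-split (cast W A) (cast ρ) with ReplaceEnv-split A ρ
... | A' , B' , refl , ρA , ρB = cast W A' , B' , refl , cast ρA , ρB

ReplaceEnv-,δ : ∀ {V G G' X X' b} → ReplaceEnv V 0 G G' →
                Replace (binders G) (lift (suc (binders G)) 0 V) X X' b → ReplaceEnv V 0 (G ,δ X) (G' ,δ X')
ReplaceEnv-,δ {X' = X'} ρ r =
  subst (λ h → ReplaceEnv _ 0 _ (plug _ (abbr X' (sort h)))) (ReplaceEnv-terminal ρ) (ReplaceEnv-plug ρ (abbr r sort))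

ReplaceEnv-,λ : ∀ {V G G' W W' b} → ReplaceEnv V 0 G G' →
                Replace (binders G) (lift (suc (binders G)) 0 V) W W' b → ReplaceEnv V 0 (G ,λ W) (G' ,λ W')
ReplaceEnv-,λ {W' = W'} ρ r =
  subst (λ h → ReplaceEnv _ 0 _ (plug _ (lam W' (sort h)))) (ReplaceEnv-terminal ρ) (ReplaceEnv-plug ρ (lam r sort))

data Position (E : Env) (V : Term) (G C₁ : Env) : Item → Env → Set where
  in-G : ∀ Y {it C₂} → C₁ ≡ E · δ[ V ] · Y → G ≡ plug Y (item it C₂) → Position E V G C₁ it C₂
  at-δ : (∀ Z → plug C₁ Z ≡ plug E Z) → Position E V G C₁ δ[ V ] G
  in-E : ∀ B {it C₂} → E ≡ plug C₁ (item it B) → C₂ ≡ plug B (abbr V G) → Position E V G C₁ it C₂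

position : ∀ {E V G C₁ it C₂} → plug C₁ (item it C₂) ≡ E · δ[ V ] · G → Position E V G C₁ it C₂
position {E} {V} {G} {C₁} {it} {C₂} e with locate C₁ it C₂ E (abbr V G) e
... | in-prefix B p q = in-E B p q
... | in-suffix (abbr X Y) p q with abbr-injective q
...   | refl , q' = in-G Y p q'
position {E} {it = δ[ X ]} e | in-suffix (sort h) refl refl = at-δ (plug-assoc E (sort h))
position {it = λ[ W ]}     e | in-suffix (sort h) _ ()
position e | in-suffix (lam _ _)  _ ()
position e | in-suffix (appl _ _) _ ()
position e | in-suffix (cast _ _) _ ()

Replace-lift-below : ∀ m V {n W W' b} → Replace n (lift (suc n) 0 V) W W' b →
                     Replace (n + m) (lift (suc (n + m)) 0 V) (lift m 0 W) (lift m 0 W') b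
Replace-lift-below m V {n} {W} {W'} {b} r =
  subst (λ X → Replace (n + m) X (lift m 0 W) (lift m 0 W') b) (lift-merge m (suc n) 0 0 V z≤n z≤n) (Replace-lift m 0 r)

Replace-under-binder : ∀ V {n m T T' b} → suc n ≡ m →
                       Replace (suc n) (lift 1 0 (lift (suc n) 0 V)) T T' b → Replace m (lift (suc m) 0 V) T T' b
Replace-under-binder V {n} {T = T} {T'} {b} refl = subst (λ X → Replace (suc n) X T T' b) (lift-1-lift n V)

unfold-⇔ : ∀ E V G {n Y Y' b} → n ≡ binders G → Replace n (lift (suc n) 0 V) Y Y' b → E · δ[ V ] · G ⊢ Y ⇔ Y'
unfold-⇔ E V G {b = true}          refl r = step (unfold refl refl (¬Occurs-lift-suc _ V , Replace-true⇒Occurs r refl , r))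
unfold-⇔ E V G {Y = Y} {b = false} refl r = subst (λ Z → _ ⊢ Y ⇔ Z) (Replace-false⇒≡ r refl) (step (free refl))

-- Unfolding an item of G is simulated in G' by unfolding its replaced version and then
-- undoing, by unfold-⇔, the replacements that Replace-commute moves into the copies of the item.
⟶-replaceEnv : ∀ {Γ X Y} → Γ ⊢ X ⟶ Y → ∀ E V G G' → Γ ≡ E · δ[ V ] · G → ReplaceEnv V 0 G G' →
               E · δ[ V ] · G' ⊢ X ⇔ Y
⟶-replaceEnv (free p) E V G G' _ _ = step (free p)
⟶-replaceEnv (unfold {C₁} {V₀} {C₂} e p s) E V G G' eΓ ρ
  with position {E} {V} {G} {C₁} {δ[ V₀ ]} {C₂} (trans (sym e) eΓ)
... | at-δ hE = step (unfold (sym (hE (abbr V G'))) p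
        (subst (λ n → _ [ n :=⁺ lift (suc n) 0 V ] _) (ReplaceEnv-binders ρ) s))
... | in-E B refl refl = step (unfold (plug-assoc C₁ (abbr V₀ B) (abbr V G')) p
        (subst (λ n → _ [ n :=⁺ lift (suc n) 0 V₀ ] _) (binders-plug-cong B (cong suc (ReplaceEnv-binders ρ))) s))
... | in-G Y refl refl with ReplaceEnv-split Y ρ
...   | Y' , _ , refl , ρY , abbr {X' = V₀'} {G' = C₂'} rV ρC with s
...     | _ , o , r with Replace-commute r (Replace-lift-below (suc (binders C₂)) V rV)
...       | Y'' , _ , r' , r'' = ⇔-trans (step unfold-V₀') (⇔-sym (unfold-⇔ E V (plug Y' (abbr V₀' C₂')) idx r''))
  where
  unfold-V₀' : E · δ[ V ] · plug Y' (abbr V₀' C₂') ⊢ _ ⟶ Y''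
  unfold-V₀' = unfold {C₁ = E · δ[ V ] · Y'} (sym (plug-assoc E (abbr V Y') (abbr V₀' C₂'))) p
    (subst (λ n → _ [ n :=⁺ lift (suc n) 0 V₀' ] Y'') (ReplaceEnv-binders ρC) (¬Occurs-lift-suc _ V₀' , o , r'))

  idx : binders Y + suc (binders C₂) ≡ binders (plug Y' (abbr V₀' C₂'))
  idx = trans (cong₂ (λ a c → a + suc c) (ReplaceEnv-binders ρY) (ReplaceEnv-binders ρC))
              (sym (binders-plug-item Y' δ[ V₀' ] C₂'))

⇔-replaceEnv : ∀ {Γ X Y} → Γ ⊢ X ⇔ Y → ∀ E V G G' → Γ ≡ E · δ[ V ] · G → ReplaceEnv V 0 G G' →
               E · δ[ V ] · G' ⊢ X ⇔ Y
⇔-replaceEnv (step s)        E V G G' e ρ = ⟶-replaceEnv s E V G G' e ρ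
⇔-replaceEnv (⇔-sym c)       E V G G' e ρ = ⇔-sym (⇔-replaceEnv c E V G G' e ρ)
⇔-replaceEnv (⇔-trans c₁ c₂) E V G G' e ρ =
  ⇔-trans (⇔-replaceEnv c₁ E V G G' e ρ) (⇔-replaceEnv c₂ E V G G' e ρ)

⊢-unreplace-type : ∀ {E V G g n T U U' K b} →
                   (E · δ[ V ] · G) ⊢[ g ] U ∶ K → (E · δ[ V ] · G) ⊢[ g ] T ∶ U' →
                   n ≡ binders G → Replace n (lift (suc n) 0 V) U U' b → (E · δ[ V ] · G) ⊢[ g ] T ∶ U
⊢-unreplace-type {E} {V} {G} tU tT n≡ r = conv tU tT (⇔-sym (unfold-⇔ E V G n≡ r))

ReplaceStable : (ℕ → ℕ) → Env → Term → Term → Set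
ReplaceStable g Γ T U = ∀ E V G G' {T₂ b} → Γ ≡ E · δ[ V ] · G → ReplaceEnv V 0 G G' →
  Replace (binders G) (lift (suc (binders G)) 0 V) T T₂ b → (E · δ[ V ] · G') ⊢[ g ] T₂ ∶ U

replaceStable-def : ∀ {Γ g C₁ V₀ C₂ W} →
                    Γ ≡ C₁ · δ[ V₀ ] · C₂ → C₁ ⊢[ g ] V₀ ∶ W → ReplaceStable g C₁ V₀ W →
                    ReplaceStable g Γ (var (binders C₂)) (lift (suc (binders C₂)) 0 W)
replaceStable-def {g = g} {C₁} {V₀} {C₂} {W} e t ih E V G G' eΓ ρ r
  with position {E} {V} {G} {C₁} {δ[ V₀ ]} {C₂} (trans (sym e) eΓ) | Replace-var r
... | in-G Y refl refl | inj₂ (n≡ , _) = ⊥-elim (<-irrefl n≡ (binders-<-plug-item Y δ[ V₀ ] C₂))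
... | in-E B refl refl | inj₂ (n≡ , _) = ⊥-elim (<-irrefl (sym n≡) (binders-<-plug-item B δ[ V ] G))
... | in-E B refl refl | inj₁ refl =
  ⊢-var-cong W (sym (binders-plug-cong B (cong suc (ReplaceEnv-binders ρ))))
    (def (plug-assoc C₁ (abbr V₀ B) (abbr V G')) t)
... | at-δ hE | inj₁ refl = ⊢-var-cong W (sym (ReplaceEnv-binders ρ)) (def (sym (hE (abbr V G'))) t)
... | at-δ hE | inj₂ (_ , refl) =
  subst₂ (λ Δ n → Δ ⊢[ g ] lift (suc n) 0 V ∶ lift (suc n) 0 W) (hE (abbr V G')) (sym (ReplaceEnv-binders ρ))
    (⊢-extend t (abbr V G'))
... | in-G Y refl refl | inj₁ refl with ReplaceEnv-split Y ρ
...   | Y' , _ , refl , ρY , abbr {X' = V₀'} {G' = C₂'} rV ρC =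
  ⊢-var-cong W (sym (ReplaceEnv-binders ρC))
    (def (sym (plug-assoc E (abbr V Y') (abbr V₀' C₂'))) (ih E V Y Y' refl ρY rV))

replaceStable-decl : ∀ {Γ g C₁ W₀ C₂ V₀} →
                     Γ ≡ C₁ · λ[ W₀ ] · C₂ → C₁ ⊢[ g ] W₀ ∶ V₀ → ReplaceStable g C₁ W₀ V₀ →
                     ReplaceStable g Γ (var (binders C₂)) (lift (suc (binders C₂)) 0 W₀)
replaceStable-decl {g = g} {C₁} {W₀} {C₂} {V₀} e t ih E V G G' eΓ ρ r
  with position {E} {V} {G} {C₁} {λ[ W₀ ]} {C₂} (trans (sym e) eΓ) | Replace-var r
... | in-G Y refl refl | inj₂ (n≡ , _) = ⊥-elim (<-irrefl n≡ (binders-<-plug-item Y λ[ W₀ ] C₂))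
... | in-E B refl refl | inj₂ (n≡ , _) = ⊥-elim (<-irrefl (sym n≡) (binders-<-plug-item B δ[ V ] G))
... | in-E B refl refl | inj₁ refl =
  ⊢-var-cong W₀ (sym (binders-plug-cong B (cong suc (ReplaceEnv-binders ρ))))
    (decl (plug-assoc C₁ (lam W₀ B) (abbr V G')) t)
... | in-G Y refl refl | inj₁ refl with ReplaceEnv-split Y ρ
...   | Y' , _ , refl , ρY , lam {W' = W₀'} {G' = C₂'} rW ρC =
  ⊢-var-cong W₀ (sym (ReplaceEnv-binders ρC))
    (⊢-unreplace-type tW₀ (decl (sym env) (ih E V Y Y' refl ρY rW))
                      idx (Replace-lift-below (suc (binders C₂')) V rW))
  where
  env : plug (E · δ[ V ] · Y') (lam W₀' C₂') ≡ E · δ[ V ] · plug Y' (lam W₀' C₂')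
  env = plug-assoc E (abbr V Y') (lam W₀' C₂')

  tW₀ : (E · δ[ V ] · plug Y' (lam W₀' C₂'))
        ⊢[ g ] lift (suc (binders C₂')) 0 W₀ ∶ lift (suc (binders C₂')) 0 V₀
  tW₀ = subst (λ Δ → Δ ⊢[ g ] _ ∶ _) env
    (⊢-extend (ih E V Y Y' refl ρY (Replace-refl _ _ W₀)) (lam W₀' C₂'))

  idx : binders Y + suc (binders C₂') ≡ binders (plug Y' (lam W₀' C₂'))
  idx = trans (cong (_+ suc (binders C₂')) (ReplaceEnv-binders ρY)) (sym (binders-plug-item Y' λ[ W₀' ] C₂'))

replaceStable-abbr : ∀ {Γ g V₀ W T U} → ReplaceStable g Γ V₀ W → ReplaceStable g (Γ ,δ V₀) T U →
                     ReplaceStable g Γ (abbr V₀ T) (abbr V₀ U)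
replaceStable-abbr {g = g} {V₀} {T = T} {U} ihV ihT E V G G' refl ρ (abbr r₁ r₂) =
  ⊢-unreplace-type (abbr (ihV E V G G' refl ρ (Replace-refl _ _ V₀))
                         (proj₂ (⊢-valid (body (Replace-refl _ _ V₀) (Replace-refl _ _ T)))))
                   (abbr (ihV E V G G' refl ρ r₁) (body r₁ r₂))
                   (ReplaceEnv-binders ρ) (abbr r₁ (Replace-refl _ _ U))
  where
  body : ∀ {X T₂ b₁ b₂} → Replace (binders G) (lift (suc (binders G)) 0 V) V₀ X b₁ →
         Replace (suc (binders G)) (lift 1 0 (lift (suc (binders G)) 0 V)) T T₂ b₂ →
         ((E · δ[ V ] · G') ,δ X) ⊢[ g ] T₂ ∶ U
  body {X} r₁ r₂ = subst (λ Δ → Δ ⊢[ g ] _ ∶ U) (sym (,δ-plug E (abbr V G') X))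
    (ihT E V (G ,δ V₀) (G' ,δ X) (,δ-plug E (abbr V G) V₀) (ReplaceEnv-,δ ρ r₁)
      (Replace-under-binder V (sym (binders-,δ G V₀)) r₂))

replaceStable-abst : ∀ {Γ g W₀ V₀ T U} → ReplaceStable g Γ W₀ V₀ → ReplaceStable g (Γ ,λ W₀) T U →
                     ReplaceStable g Γ (lam W₀ T) (lam W₀ U)
replaceStable-abst {g = g} {W₀} {T = T} {U} ihW ihT E V G G' refl ρ (lam r₁ r₂) =
  ⊢-unreplace-type (abst (ihW E V G G' refl ρ (Replace-refl _ _ W₀))
                         (proj₂ (⊢-valid (body (Replace-refl _ _ W₀) (Replace-refl _ _ T)))))
                   (abst (ihW E V G G' refl ρ r₁) (body r₁ r₂))
                   (ReplaceEnv-binders ρ) (lam r₁ (Replace-refl _ _ U))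
  where
  body : ∀ {X T₂ b₁ b₂} → Replace (binders G) (lift (suc (binders G)) 0 V) W₀ X b₁ →
         Replace (suc (binders G)) (lift 1 0 (lift (suc (binders G)) 0 V)) T T₂ b₂ →
         ((E · δ[ V ] · G') ,λ X) ⊢[ g ] T₂ ∶ U
  body {X} r₁ r₂ = subst (λ Δ → Δ ⊢[ g ] _ ∶ U) (sym (,λ-plug E (abbr V G') X))
    (ihT E V (G ,λ W₀) (G' ,λ X) (,λ-plug E (abbr V G) W₀) (ReplaceEnv-,λ ρ r₁)
      (Replace-under-binder V (sym (binders-,λ G W₀)) r₂))

replaceStable-appl : ∀ {Γ g V₀ W T U} → ReplaceStable g Γ V₀ W → ReplaceStable g Γ T (lam W U) →
                     ReplaceStable g Γ (appl V₀ T) (appl V₀ (lam W U))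
replaceStable-appl {V₀ = V₀} {W} {U = U} ihV ihT E V G G' refl ρ (appl r₁ r₂)
  with ⊢-lam-inv (proj₂ (⊢-valid (ihT E V G G' refl ρ r₂)))
... | _ , _ , tW , tU =
  ⊢-unreplace-type (appl (ihV E V G G' refl ρ (Replace-refl _ _ V₀)) (abst tW tU))
                   (appl (ihV E V G G' refl ρ r₁) (ihT E V G G' refl ρ r₂))
                   (ReplaceEnv-binders ρ) (appl r₁ (Replace-refl _ _ (lam W U)))

replaceStable-cast : ∀ {Γ g T W V₀} → ReplaceStable g Γ T W → ReplaceStable g Γ W V₀ →
                     ReplaceStable g Γ (cast W T) (cast V₀ W)
replaceStable-cast {W = W} {V₀} ihT ihW E V G G' refl ρ (cast r₁ r₂) =
  ⊢-unreplace-type (cast tW (proj₂ (⊢-valid tW)))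
                   (cast (conv tW' (ihT E V G G' refl ρ r₂) (unfold-⇔ E V G' (ReplaceEnv-binders ρ) r₁)) tW')
                   (ReplaceEnv-binders ρ) (cast (Replace-refl _ _ V₀) r₁)
  where
  tW  = ihW E V G G' refl ρ (Replace-refl _ _ W)
  tW' = ihW E V G G' refl ρ r₁

replaceStable-conv : ∀ {Γ g T U₁ U₂ K} →
                     ReplaceStable g Γ U₂ K → ReplaceStable g Γ T U₁ → Γ ⊢ U₁ ⇔ U₂ →
                     ReplaceStable g Γ T U₂
replaceStable-conv {U₂ = U₂} ihU ihT c E V G G' eΓ ρ r =
  conv (ihU E V G G' eΓ ρ (Replace-refl _ _ U₂)) (ihT E V G G' eΓ ρ r) (⇔-replaceEnv c E V G G' eΓ ρ)

⊢-replace : ∀ {Γ g T U} → Γ ⊢[ g ] T ∶ U → ReplaceStable g Γ T U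
⊢-replace sort E V G G' _ _ sort = sort
⊢-replace (def e t)      = replaceStable-def e t (⊢-replace t)
⊢-replace (decl e t)     = replaceStable-decl e t (⊢-replace t)
⊢-replace (abbr tV tT)   = replaceStable-abbr (⊢-replace tV) (⊢-replace tT)
⊢-replace (abst tW tT)   = replaceStable-abst (⊢-replace tW) (⊢-replace tT)
⊢-replace (appl tV tT)   = replaceStable-appl (⊢-replace tV) (⊢-replace tT)
⊢-replace (cast tT tW)   = replaceStable-cast (⊢-replace tT) (⊢-replace tW)
⊢-replace (conv tU tT c) = replaceStable-conv (⊢-replace tU) (⊢-replace tT) c

mainTheorem15 : (g : ℕ → ℕ) → (∀ h → h < g h) →
    ∀ (C E E' : Env) (T₁ T₂ T V : Term) →
    C ⊢[ g ] T₁ ∶ T →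
    T₁ [ binders E' :=⁺ lift (suc (binders E')) 0 V ] T₂ →
    C ≡ E · δ[ V ] · E' →
    C ⊢[ g ] T₂ ∶ T
mainTheorem15 g _ C E E' T₁ T₂ T V t (_ , _ , r) e =
  subst (λ Γ → Γ ⊢[ g ] T₂ ∶ T) (sym e) (⊢-replace t E V E' E' e (ReplaceEnv-refl 0 E') r)
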